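{- Let $\psi\colon\Gamma\to\Gamma$ be the automorphism of $\Gamma=\mathrm{PSL}_2(\mathbb{Z})$ given by $\psi\begin{pmatrix}a&b\\c&d\end{pmatrix}=\begin{pmatrix}a&-b\\-c&d\end{pmatrix}$. Let $\sigma=(12)(36)(45)\in S_7$. Then $\psi(G_j)=G_{\sigma(j)}$ and $\psi(H_j)=H_{\sigma(j)}$ for all $j=1,\dots,7$, and $\psi(U_1)=V_2$, $\psi(U_2)=V_1$, $\psi(U_3)=V_4$, $\psi(U_4)=V_3$, $\psi(U_5)=V_5$, $\psi(U_6)=V_6$, $\psi(U_7)=V_7$.
   Context: Let $S,T\in\Gamma$ be the images of $\begin{pmatrix}0&-1\\1&0\end{pmatrix}$ and $\begin{pmatrix}1&1\\0&1\end{pmatrix}$, and $R=ST$; $\Gamma$ is the free product of $\langle S\rangle\cong\mathbb{Z}/2$ and $\langle R\rangle\cong\mathbb{Z}/3$. Permutations compose right to left. Define homomorphisms $\phi_i\colon\Gamma\to S_7$ by: $\phi_1(S)=(12)(34)(56)$, $\phi_1(R)=(235)(467)$; $\phi_2(S)=(12)(34)(56)$, $\phi_2(R)=(235)(764)$; $\phi_3(S)=(12)(34)(67)$, $\phi_3(R)=(235)(467)$; $\phi_4(S)=(12)(34)(67)$, $\phi_4(R)=(253)(467)$. For $j=1,\dots,7$: $G_j=\phi_1^{ -1}(\mathrm{Stab}(j))$, $H_j=\phi_2^{ -1}(\mathrm{Stab}(j))$, $U_j=\phi_3^{ -1}(\mathrm{Stab}(j))$, $V_j=\phi_4^{ -1}(\mathrm{Stab}(j))$.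 -}

module Defs where

open import Data.Nat using (ℕ; _≟_; _≤_)
open import Data.Integer using (ℤ; +_; -_; -[1+_]) renaming (_+_ to _+ℤ_; _*_ to _*ℤ_; _-_ to _-ℤ_)
open import Data.List using (List; []; _∷_)
open import Data.Product using (Σ; ∃; _×_; _,_)
open import Data.Sum using (_⊎_)
open import Relation.Nullary using (yes; no)
open import Relation.Binary.PropositionalEquality using (_≡_)

record M2 : Set where
  constructor mat
  field
    a b c d : ℤ
open M2 public

det : M2 → ℤ
det (mat a b c d) = (a *ℤ d) -ℤ (b *ℤ c)

_⊗_ : M2 → M2 → M2
mat a b c d ⊗ mat a' b' c' d' =
  mat (a *ℤ a' +ℤ b *ℤ c') (a *ℤ b' +ℤ b *ℤ d')
      (c *ℤ a' +ℤ d *ℤ c') (c *ℤ b' +ℤ d *ℤ d')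

negM : M2 → M2
negM (mat a b c d) = mat (- a) (- b) (- c) (- d)

I₂ : M2
I₂ = mat (+ 1) (+ 0) (+ 0) (+ 1)

-- equality in PSL₂(ℤ): matrices agree up to sign
_≈Γ_ : M2 → M2 → Set
M ≈Γ N = (M ≡ N) ⊎ (M ≡ negM N)

-- an element of Γ is (represented by) a matrix of determinant 1
IsSL2 : M2 → Set
IsSL2 M = det M ≡ + 1

Sm Tm Rm : M2
Sm = mat (+ 0) (- (+ 1)) (+ 1) (+ 0)
Tm = mat (+ 1) (+ 1) (+ 0) (+ 1)
Rm = Sm ⊗ Tm

ψ : M2 → M2
ψ (mat a b c d) = mat a (- b) (- c) d

data Gen : Set where
  gS gR : Gen

Word : Set
Word = List Gen

genMat : Gen → M2
genMat gS = Sm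
genMat gR = Rm

evalW : Word → M2
evalW []      = I₂
evalW (g ∷ w) = genMat g ⊗ evalW w

-- Permutations of {1,…,7}, as functions ℕ → ℕ (identity outside 1..7)
-- composition is right to left: (π ∘ ρ) x = π (ρ x)

Perm : Set
Perm = ℕ → ℕ

-- cycle (a₀ a₁ … a_k): aᵢ ↦ aᵢ₊₁, a_k ↦ a₀, everything else fixed
-- cycAux first a rest x : a is the current element, rest the remaining ones
cycAux : ℕ → ℕ → List ℕ → ℕ → ℕ
cycAux first a []       x with x ≟ a
... | yes _ = first
... | no  _ = x
cycAux first a (b ∷ rest) x with x ≟ a
... | yes _ = b
... | no  _ = cycAux first b rest x

cyc : List ℕ → Perm
cyc []      x = x
cyc (a ∷ l) x = cycAux a a l x

-- product of cycles, composed right to left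
cycs : List (List ℕ) → Perm
cycs []       x = x
cycs (c ∷ cs) x = cyc c (cycs cs x)

-- a homomorphism Γ → S₇ given by the images of S and R
record Hom : Set where
  constructor hom
  field
    imS imR : Perm
open Hom public

genPerm : Hom → Gen → Perm
genPerm φ gS = imS φ
genPerm φ gR = imR φ

evalP : Hom → Word → Perm
evalP φ []      x = x
evalP φ (g ∷ w) x = genPerm φ g (evalP φ w x)

φ₁ φ₂ φ₃ φ₄ : Hom
φ₁ = hom (cycs ((1 ∷ 2 ∷ []) ∷ (3 ∷ 4 ∷ []) ∷ (5 ∷ 6 ∷ []) ∷ []))
         (cycs ((2 ∷ 3 ∷ 5 ∷ []) ∷ (4 ∷ 6 ∷ 7 ∷ []) ∷ []))
φ₂ = hom (cycs ((1 ∷ 2 ∷ []) ∷ (3 ∷ 4 ∷ []) ∷ (5 ∷ 6 ∷ []) ∷ []))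
         (cycs ((2 ∷ 3 ∷ 5 ∷ []) ∷ (7 ∷ 6 ∷ 4 ∷ []) ∷ []))
φ₃ = hom (cycs ((1 ∷ 2 ∷ []) ∷ (3 ∷ 4 ∷ []) ∷ (6 ∷ 7 ∷ []) ∷ []))
         (cycs ((2 ∷ 3 ∷ 5 ∷ []) ∷ (4 ∷ 6 ∷ 7 ∷ []) ∷ []))
φ₄ = hom (cycs ((1 ∷ 2 ∷ []) ∷ (3 ∷ 4 ∷ []) ∷ (6 ∷ 7 ∷ []) ∷ []))
         (cycs ((2 ∷ 5 ∷ 3 ∷ []) ∷ (4 ∷ 6 ∷ 7 ∷ []) ∷ []))

σ : Perm
σ = cycs ((1 ∷ 2 ∷ []) ∷ (3 ∷ 6 ∷ []) ∷ (4 ∷ 5 ∷ []) ∷ [])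

-- Preimage of a point stabiliser: M ∈ φ⁻¹(Stab j)
-- (M ∈ Γ is written as a word in S, R; φ is well defined on Γ since
--  Γ = ⟨S⟩ * ⟨R⟩ and φ(S)² = φ(R)³ = 1)

PreStab : Hom → ℕ → M2 → Set
PreStab φ j M = IsSL2 M × (Σ Word λ w → (evalW w ≈Γ M) × (evalP φ w j ≡ j))

G H U V : ℕ → M2 → Set
G = PreStab φ₁
H = PreStab φ₂
U = PreStab φ₃
V = PreStab φ₄

-- ψ(A) = B as subsets of Γ
ImageEq : (M2 → Set) → (M2 → Set) → Set
ImageEq A B =
  (∀ M → A M → B (ψ M)) ×
  (∀ N → B N → Σ M2 λ M → A M × (ψ M ≈Γ N))

InRange : ℕ → Set
InRange j = (1 ≤ j) × (j ≤ 7)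

module Submission where

-- The matrix map ψ (a b; c d) ↦ (a -b; -c d) is multiplicative, preserves
-- the determinant, commutes with negation and is an involution, so it induces an
-- automorphism of Γ.  On the generators it is given by words:
--   ψ(S) = S³ and ψ(R) = S R² S  (exact matrix identities),
-- so every word w has a twisted word ψw w with evalW (ψw w) = ψ (evalW w).
-- A permutation π *intertwines* φ with φ' if π ∘ φ(g) = φ'(ψ g) ∘ π for both
-- generators g; this then holds for all words, hence π maps the φ-stabiliser of j
-- to the φ'-stabiliser of π j, i.e. ψ(φ⁻¹ Stab j) ⊆ φ'⁻¹ Stab (π j).  If π is an
-- involution intertwining in both directions, the inclusion is an equality.
-- The theorem follows with π = σ for φ₁ and φ₂, and π = τ = (12)(34) from φ₃ to
-- φ₄; the finitely many intertwining and involution identities are checked by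
-- evaluating both sides on 0,…,7 (above 7 all permutations are the identity).

open import Defs
open import Data.Nat using (ℕ; _+_; _∸_; _<?_)
open import Data.Nat.Properties using (m+[n∸m]≡n; ≮⇒≥; _≟_)
open import Data.Product using (_×_; _,_)
open import Data.Sum using (inj₁; inj₂)
open import Data.List using ([]; _∷_; _++_; upTo)
open import Data.List.Relation.Unary.All using (All; all?)
import Data.List.Relation.Unary.All as All
open import Data.List.Membership.Propositional.Properties using (∈-upTo⁺)
open import Data.Integer using (+_; -_) renaming (_+_ to _+ℤ_; _*_ to _*ℤ_; _-_ to _-ℤ_)
open import Data.Integer.Properties using (neg-involutive)
open import Data.Integer.Tactic.RingSolver using (solve-∀)
open import Relation.Nullary using (yes; no)
open import Relation.Nullary.Decidable using (True; toWitness)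
open import Relation.Binary.PropositionalEquality
  using (_≡_; refl; sym; trans; cong; cong₂; subst; module ≡-Reasoning)

mat-cong : ∀ {a b c d a' b' c' d'} →
  a ≡ a' → b ≡ b' → c ≡ c' → d ≡ d' → mat a b c d ≡ mat a' b' c' d'
mat-cong refl refl refl refl = refl

⊗-assoc : ∀ A B C → (A ⊗ B) ⊗ C ≡ A ⊗ (B ⊗ C)
⊗-assoc (mat a b c d) (mat a' b' c' d') (mat a'' b'' c'' d'') =
  mat-cong (entry a b a' b' c' d' a'' c'') (entry a b a' b' c' d' b'' d'')
           (entry c d a' b' c' d' a'' c'') (entry c d a' b' c' d' b'' d'')
  where
  entry : ∀ x y a' b' c' d' p q →
    (x *ℤ a' +ℤ y *ℤ c') *ℤ p +ℤ (x *ℤ b' +ℤ y *ℤ d') *ℤ q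
      ≡ x *ℤ (a' *ℤ p +ℤ b' *ℤ q) +ℤ y *ℤ (c' *ℤ p +ℤ d' *ℤ q)
  entry = solve-∀

⊗-identityˡ : ∀ A → I₂ ⊗ A ≡ A
⊗-identityˡ (mat a b c d) = mat-cong (top a c) (top b d) (bottom a c) (bottom b d)
  where
  top : ∀ p q → + 1 *ℤ p +ℤ + 0 *ℤ q ≡ p
  top = solve-∀
  bottom : ∀ p q → + 0 *ℤ p +ℤ + 1 *ℤ q ≡ q
  bottom = solve-∀

-- ψ is conjugation by diag(1,-1): multiplicative, involutive, commutes with
-- negation and preserves the determinant, so it is an automorphism of Γ.
ψ-⊗ : ∀ A B → ψ (A ⊗ B) ≡ ψ A ⊗ ψ B
ψ-⊗ (mat a b c d) (mat a' b' c' d') =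
  mat-cong (entry₁₁ a b a' c') (entry₁₂ a b b' d') (entry₂₁ c d a' c') (entry₂₂ c d b' d')
  where
  entry₁₁ : ∀ x y p q → x *ℤ p +ℤ y *ℤ q ≡ x *ℤ p +ℤ (- y) *ℤ (- q)
  entry₁₁ = solve-∀
  entry₁₂ : ∀ x y p q → - (x *ℤ p +ℤ y *ℤ q) ≡ x *ℤ (- p) +ℤ (- y) *ℤ q
  entry₁₂ = solve-∀
  entry₂₁ : ∀ x y p q → - (x *ℤ p +ℤ y *ℤ q) ≡ (- x) *ℤ p +ℤ y *ℤ (- q)
  entry₂₁ = solve-∀
  entry₂₂ : ∀ x y p q → x *ℤ p +ℤ y *ℤ q ≡ (- x) *ℤ (- p) +ℤ y *ℤ q
  entry₂₂ = solve-∀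

ψ-involutive : ∀ M → ψ (ψ M) ≡ M
ψ-involutive (mat a b c d) = mat-cong refl (neg-involutive b) (neg-involutive c) refl

ψ-negM : ∀ M → ψ (negM M) ≡ negM (ψ M)
ψ-negM (mat a b c d) = refl

det-ψ : ∀ M → det (ψ M) ≡ det M
det-ψ (mat a b c d) = identity a b c d
  where
  identity : ∀ a b c d → a *ℤ d -ℤ (- b) *ℤ (- c) ≡ a *ℤ d -ℤ b *ℤ c
  identity = solve-∀

ψ-≈Γ : ∀ {M N} → M ≈Γ N → ψ M ≈Γ ψ N
ψ-≈Γ (inj₁ M≡N)          = inj₁ (cong ψ M≡N)
ψ-≈Γ {N = N} (inj₂ M≡-N) = inj₂ (trans (cong ψ M≡-N) (ψ-negM N))

ψGen : Gen → Word
ψGen gS = gS ∷ gS ∷ gS ∷ []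
ψGen gR = gS ∷ gR ∷ gR ∷ gS ∷ []

ψGen-correct : ∀ g → evalW (ψGen g) ≡ ψ (genMat g)
ψGen-correct gS = refl
ψGen-correct gR = refl

ψWord : Word → Word
ψWord []      = []
ψWord (g ∷ w) = ψGen g ++ ψWord w

evalW-++ : ∀ u v → evalW (u ++ v) ≡ evalW u ⊗ evalW v
evalW-++ []      v = sym (⊗-identityˡ (evalW v))
evalW-++ (g ∷ u) v =
  trans (cong (genMat g ⊗_) (evalW-++ u v)) (sym (⊗-assoc (genMat g) (evalW u) (evalW v)))

evalW-ψWord : ∀ w → evalW (ψWord w) ≡ ψ (evalW w)
evalW-ψWord []      = refl
evalW-ψWord (g ∷ w) = begin
  evalW (ψGen g ++ ψWord w)              ≡⟨ evalW-++ (ψGen g) (ψWord w) ⟩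
  evalW (ψGen g) ⊗ evalW (ψWord w)       ≡⟨ cong₂ _⊗_ (ψGen-correct g) (evalW-ψWord w) ⟩
  ψ (genMat g) ⊗ ψ (evalW w)             ≡⟨ sym (ψ-⊗ (genMat g) (evalW w)) ⟩
  ψ (genMat g ⊗ evalW w)                 ∎
  where open ≡-Reasoning

evalP-++ : ∀ φ u v x → evalP φ (u ++ v) x ≡ evalP φ u (evalP φ v x)
evalP-++ φ []      v x = refl
evalP-++ φ (g ∷ u) v x = cong (genPerm φ g) (evalP-++ φ u v x)

Intertwines : Hom → Hom → Perm → Set
Intertwines φ φ' π = ∀ g x → π (genPerm φ g x) ≡ evalP φ' (ψGen g) (π x)

intertwine-word : ∀ {φ φ' π} → Intertwines φ φ' π →
  ∀ w x → evalP φ' (ψWord w) (π x) ≡ π (evalP φ w x)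
intertwine-word gen []      x = refl
intertwine-word {φ} {φ'} {π} gen (g ∷ w) x = begin
  evalP φ' (ψGen g ++ ψWord w) (π x)       ≡⟨ evalP-++ φ' (ψGen g) (ψWord w) (π x) ⟩
  evalP φ' (ψGen g) (evalP φ' (ψWord w) (π x))
                                           ≡⟨ cong (evalP φ' (ψGen g)) (intertwine-word gen w x) ⟩
  evalP φ' (ψGen g) (π (evalP φ w x))      ≡⟨ sym (gen g (evalP φ w x)) ⟩
  π (genPerm φ g (evalP φ w x))            ∎
  where open ≡-Reasoning

ψ-PreStab : ∀ {φ φ' π} → Intertwines φ φ' π →
  ∀ j M → PreStab φ j M → PreStab φ' (π j) (ψ M)
ψ-PreStab {π = π} gen j M (detM , w , w≈M , fixes) =
  trans (det-ψ M) detM ,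
  ψWord w ,
  subst (_≈Γ ψ M) (sym (evalW-ψWord w)) (ψ-≈Γ w≈M) ,
  trans (intertwine-word gen w j) (cong π fixes)

ψ-PreStab-image : ∀ {φ φ' π} → Intertwines φ φ' π → Intertwines φ' φ π →
  (∀ x → π (π x) ≡ x) → ∀ j → ImageEq (PreStab φ j) (PreStab φ' (π j))
ψ-PreStab-image {φ} {π = π} forward backward involutive j =
  ψ-PreStab forward j ,
  λ N N∈ → ψ N ,
           subst (λ i → PreStab φ i (ψ N)) (involutive j) (ψ-PreStab backward (π j) N N∈) ,
           inj₁ (ψ-involutive N)

agree-everywhere : ∀ n (f g : Perm) → All (λ x → f x ≡ g x) (upTo n) →
  (∀ k → f (n + k) ≡ g (n + k)) → ∀ x → f x ≡ g x
agree-everywhere n f g below above x with x <? n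
... | yes x<n = All.lookup below (∈-upTo⁺ x<n)
... | no  x≮n = subst (λ y → f y ≡ g y) (m+[n∸m]≡n (≮⇒≥ x≮n)) (above (x ∸ n))

-- All permutations in this file fix every point ≥ 8, so agreeing on 0,…,7
-- (decided by evaluation) suffices.
agree-by-evaluation : (f g : Perm) → True (all? (λ x → f x ≟ g x) (upTo 8)) →
  (∀ k → f (8 + k) ≡ g (8 + k)) → ∀ x → f x ≡ g x
agree-by-evaluation f g check = agree-everywhere 8 f g (toWitness check)

τ : Perm
τ = cycs ((1 ∷ 2 ∷ []) ∷ (3 ∷ 4 ∷ []) ∷ [])

σ-involutive : ∀ x → σ (σ x) ≡ x
σ-involutive = agree-by-evaluation _ _ _ (λ _ → refl)

τ-involutive : ∀ x → τ (τ x) ≡ x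
τ-involutive = agree-by-evaluation _ _ _ (λ _ → refl)

σ-intertwines-φ₁ : Intertwines φ₁ φ₁ σ
σ-intertwines-φ₁ gS = agree-by-evaluation _ _ _ (λ _ → refl)
σ-intertwines-φ₁ gR = agree-by-evaluation _ _ _ (λ _ → refl)

σ-intertwines-φ₂ : Intertwines φ₂ φ₂ σ
σ-intertwines-φ₂ gS = agree-by-evaluation _ _ _ (λ _ → refl)
σ-intertwines-φ₂ gR = agree-by-evaluation _ _ _ (λ _ → refl)

τ-intertwines-φ₃-φ₄ : Intertwines φ₃ φ₄ τ
τ-intertwines-φ₃-φ₄ gS = agree-by-evaluation _ _ _ (λ _ → refl)
τ-intertwines-φ₃-φ₄ gR = agree-by-evaluation _ _ _ (λ _ → refl)

τ-intertwines-φ₄-φ₃ : Intertwines φ₄ φ₃ τ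
τ-intertwines-φ₄-φ₃ gS = agree-by-evaluation _ _ _ (λ _ → refl)
τ-intertwines-φ₄-φ₃ gR = agree-by-evaluation _ _ _ (λ _ → refl)

-- Lemma 5.1.  For G and H the statement holds for every j, not only 1 ≤ j ≤ 7;
-- for U and V, ψ(U_j) = V_{τ j} with τ = (12)(34).
lemma5p1 :
    (∀ (j : ℕ) → InRange j → ImageEq (G j) (G (σ j)) × ImageEq (H j) (H (σ j)))
    × ImageEq (U 1) (V 2) × ImageEq (U 2) (V 1) × ImageEq (U 3) (V 4)
    × ImageEq (U 4) (V 3) × ImageEq (U 5) (V 5) × ImageEq (U 6) (V 6)
    × ImageEq (U 7) (V 7)
lemma5p1 = (λ j _ → ψG j , ψH j) , ψU 1 , ψU 2 , ψU 3 , ψU 4 , ψU 5 , ψU 6 , ψU 7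
  where
  ψG : ∀ j → ImageEq (G j) (G (σ j))
  ψG = ψ-PreStab-image σ-intertwines-φ₁ σ-intertwines-φ₁ σ-involutive
  ψH : ∀ j → ImageEq (H j) (H (σ j))
  ψH = ψ-PreStab-image σ-intertwines-φ₂ σ-intertwines-φ₂ σ-involutive
  ψU : ∀ j → ImageEq (U j) (V (τ j))
  ψU = ψ-PreStab-image τ-intertwines-φ₃-φ₄ τ-intertwines-φ₄-φ₃ τ-involutive
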